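{- For all integers $n,m\geq 0$, the higher order Bell number satisfies $b_n^{(m)}=\langle B_n^{(m)},p_{1^n}\rangle$, where $\langle\cdot,\cdot\rangle$ is the Hall inner product and $p_{1^n}=p_1^n$.
   Context: Let $\Lambda$ be the ring of symmetric functions over $\mathbb{Q}$ in variables $X=(x_1,x_2,\ldots)$, completed with respect to degree (formal sums $\sum_{n\ge0}F_n$ with $F_n$ homogeneous of degree $n$). Write $h_n$ for complete homogeneous and $p_\lambda$ for power sum symmetric functions. Plethysm: for a formal power series $A$ in the $x_i$ and auxiliary commuting variables (e.g. $t$), $p_k(A)$ is obtained from $A$ by replacing every variable by its $k$-th power, and for $F\in\Lambda$, $F(A)$ is obtained by writing $F$ in terms of the $p_k$ and substituting $p_k\mapsto p_k(A)$ (used only when $A$ has zero constant term, or $F$ is a polynomial). The alphabet $tX$ means $(tx_1,tx_2,\ldots)$, so $p_k(tX)=t^kp_k(X)$. Let $\Omega(X)=\sum_{n\ge0}h_n(X)$ and $\Omega_0(X)=\Omega(X)-1$. Define $\Omega_0^{(0)}(X)=h_1(X)$ and $\Omega_0^{(m+1)}(X)=\Omega_0(\Omega_0^{(m)}(X))$. The higher order Bell symmetric functions $B_n^{(m)}$ are defined by $\Omega(\Omega_0^{(m)}(tX))=\sum_{n\ge0}B_n^{(m)}(X)t^n$. The Hall inner product is the bilinear pairing with $\langle p_\lambda,p_\mu\rangle=z_\lambda\delta_{\lambda\mu}$, where $z_\lambda=\prod_{j\ge1}m_j(\lambda)!\,j^{m_j(\lambda)}$ and $m_j(\lambda)$ is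 the number of parts of $\lambda$ equal to $j$. The higher order Bell numbers: define power series $E^{(0)}(t)=\exp(t)$ and $E^{(m+1)}(t)=E^{(m)}(\exp(t)-1)$; then $E^{(m)}(t)=\sum_{n\ge0}\frac{b_n^{(m)}}{n!}t^n$. -}

module Defs where

open import Data.Nat as ℕ using (ℕ; zero; suc; _!; _≟_)
open import Data.Nat.Properties using (_!≢0; m*n≢0; m^n≢0)
open import Data.Integer using (+_)
open import Data.Rational as ℚ using (ℚ; 0ℚ; 1ℚ; _+_; _*_; -_)
open import Data.List using (List; []; _∷_; map; foldr; concatMap; upTo; replicate; length; filter; _++_)
import Data.List.Properties as LP
open import Data.Product using (_×_; _,_)
open import Data.Bool using (if_then_else_)
open import Relation.Nullary.Decidable using (does; ⌊_⌋)

-- We work in the power-sum basis: Λ ⊗ ℚ = ℚ[p₁,p₂,…].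
-- A partition is a list of positive parts in nonincreasing order; the
-- monomial p_λ = p_{λ₁} p_{λ₂} ⋯ is represented by λ.
-- A (finite) element of Λ is a ℚ-linear combination of p_λ, represented
-- as a list of (coefficient , partition) pairs (unnormalised sums).

Partition : Set
Partition = List ℕ

Sym : Set
Sym = List (ℚ × Partition)

sumℚ : List ℚ → ℚ
sumℚ = foldr _+_ 0ℚ

insertPart : ℕ → Partition → Partition
insertPart k []       = k ∷ []
insertPart k (j ∷ λs) = if does (j ℕ.≤? k) then k ∷ j ∷ λs else j ∷ insertPart k λs

-- p_λ p_μ = p_{λ ∪ μ}
unionPart : Partition → Partition → Partition
unionPart λs μs = foldr insertPart μs λs

zeroS : Sym
zeroS = []

oneS : Sym
oneS = (1ℚ , []) ∷ []

addS : Sym → Sym → Sym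
addS = _++_

scaleS : ℚ → Sym → Sym
scaleS c = map (λ { (a , λs) → (c * a , λs) })

mulS : Sym → Sym → Sym
mulS F G = concatMap (λ { (a , λs) → map (λ { (b , μs) → (a * b , unionPart λs μs) }) G }) F

sumS : List Sym → Sym
sumS = foldr addS zeroS

mult : ℕ → Partition → ℕ
mult j λs = length (filter (λ i → i ≟ j) λs)

size : Partition → ℕ
size = foldr ℕ._+_ 0

prodℕ : List ℕ → ℕ
prodℕ = foldr ℕ._*_ 1

-- z_λ = ∏_{j ≥ 1} m_j(λ)! j^{m_j(λ)}  (j ranges over 1..|λ|, the rest are 1)
z : Partition → ℕ
z λs = prodℕ (map (λ j → (mult (suc j) λs) ! ℕ.* (suc j) ℕ.^ (mult (suc j) λs)) (upTo (size λs)))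

z-nonZero : ∀ λs → ℕ.NonZero (z λs)
z-nonZero λs = go (upTo (size λs))
  where
  go : ∀ (js : List ℕ) → ℕ.NonZero (prodℕ (map (λ j → (mult (suc j) λs) ! ℕ.* (suc j) ℕ.^ (mult (suc j) λs)) js))
  go []       = _
  go (j ∷ js) =
    let instance
          nz1 = (mult (suc j) λs) !≢0
          nz2 = m^n≢0 (suc j) (mult (suc j) λs)
          nz3 = m*n≢0 ((mult (suc j) λs) !) (suc j ℕ.^ mult (suc j) λs)
          nz4 = go js
    in m*n≢0 _ _

hall : Sym → Sym → ℚ
hall F G = sumℚ (concatMap (λ { (a , λs) → map (λ { (b , μs) →
  if ⌊ LP.≡-dec _≟_ λs μs ⌋ then a * b * ((+ z λs) ℚ./ 1) else 0ℚ }) G }) F)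

partitionsLe : ℕ → ℕ → List Partition
partitionsLe zero    zero    = [] ∷ []
partitionsLe (suc n) zero    = []
partitionsLe n       (suc k) =
  concatMap (λ j → map (λ μs → replicate j (suc k) ++ μs) (partitionsLe (n ℕ.∸ j ℕ.* suc k) k))
            (filter (λ j → j ℕ.* suc k ℕ.≤? n) (upTo (suc n)))

partitions : ℕ → List Partition
partitions n = partitionsLe n n

-- h_n = Σ_{λ ⊢ n} z_λ⁻¹ p_λ  (complete homogeneous symmetric function, p-expansion)
h : ℕ → Sym
h n = map (λ λs → (ℚ._/_ (+ 1) (z λs) {{z-nonZero λs}} , λs)) (partitions n)

p1^ : ℕ → Sym
p1^ n = (1ℚ , replicate n 1) ∷ []

-- Completed ring: graded series F = Σ_n F_n, with F n the degree-n part.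

Series : Set
Series = ℕ → Sym

Σ≤ : ℕ → (ℕ → Sym) → Sym
Σ≤ n f = sumS (map f (upTo (suc n)))

oneSer : Series
oneSer zero    = oneS
oneSer (suc _) = zeroS

mulSer : Series → Series → Series
mulSer A B n = Σ≤ n (λ i → mulS (A i) (B (n ℕ.∸ i)))

-- plethysm p_k[F] on a finite element: p_λ ↦ p_{kλ}
pleth-p-Sym : ℕ → Sym → Sym
pleth-p-Sym k = map (λ { (a , λs) → (a , map (k ℕ.*_) λs) })

pleth-p : ℕ → Series → Series
pleth-p k A n = Σ≤ n (λ d → if ⌊ k ℕ.* d ≟ n ⌋ then pleth-p-Sym k (A d) else zeroS)

pleth-pλ : Partition → Series → Series
pleth-pλ λs A = foldr (λ k acc → mulSer (pleth-p k A) acc) oneSer λs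

-- F[A] = Σ_λ c_λ p_λ[A]; for A with zero constant term, only the terms
-- of F of degree ≤ n contribute to degree n.
pleth : Series → Series → Series
pleth F A n = Σ≤ n (λ d → sumS (map (λ { (c , λs) → scaleS c (pleth-pλ λs A n) }) (F d)))

Ω : Series
Ω = h

Ω₀ : Series
Ω₀ zero    = zeroS
Ω₀ (suc n) = h (suc n)

h₁Ser : Series
h₁Ser 1 = h 1
h₁Ser _ = zeroS

Ω₀^ : ℕ → Series
Ω₀^ zero    = h₁Ser
Ω₀^ (suc m) = pleth Ω₀ (Ω₀^ m)

-- Higher order Bell symmetric function B_n^{(m)}: the coefficient of tⁿ in
-- Ω[Ω₀^{(m)}[tX]], i.e. the degree-n part of Ω[Ω₀^{(m)}].
B : ℕ → ℕ → Sym
B n m = pleth Ω (Ω₀^ m) n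

PS : Set
PS = ℕ → ℚ

oneP : PS
oneP zero    = 1ℚ
oneP (suc _) = 0ℚ

mulP : PS → PS → PS
mulP f g n = sumℚ (map (λ i → f i * g (n ℕ.∸ i)) (upTo (suc n)))

powP : PS → ℕ → PS
powP f zero    = oneP
powP f (suc k) = mulP f (powP f k)

-- composition F(G) for G with zero constant term
compP : PS → PS → PS
compP f g n = sumℚ (map (λ k → f k * powP g k n) (upTo (suc n)))

expP : PS
expP n = ℚ._/_ (+ 1) (n !) {{n !≢0}}

expP₀ : PS
expP₀ zero    = 0ℚ
expP₀ (suc n) = expP (suc n)

E : ℕ → PS
E zero    = expP
E (suc m) = compP (E m) expP₀

b : ℕ → ℕ → ℚ
b n m = ((+ (n !)) ℚ./ 1) * E m n

-- The exponential specialisation ex (p₁ ↦ 1, p_k ↦ 0 for k ≠ 1) is a ring homomorphism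
-- Λ → ℚ, and since ⟨p_λ, p_{1ⁿ}⟩ = n! [λ = 1ⁿ], pairing a degree-n element F with p_{1ⁿ}
-- gives n! ex(F).  Applied degreewise to a graded series A, ex produces the power series
-- Σ ex(A_n) tⁿ; p_k[A] is killed for k ≠ 1 as soon as A has no constant term, whence
-- ex(F[A]) = ex(F) ∘ ex(A).  As ex(h_n) = 1/n!, ex(Ω) = eᵗ, ex(Ω₀) = eᵗ − 1 and
-- ex(Ω₀^{(m)}) = (eᵗ − 1)^{∘m}.  Finally E^{(m)}, which composes with eᵗ − 1 on the right,
-- equals eᵗ ∘ (eᵗ − 1)^{∘m} by associativity of composition, so
-- b_n^{(m)} = n! [tⁿ] ex(Ω[Ω₀^{(m)}]) = ⟨B_n^{(m)}, p_{1ⁿ}⟩.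

{-# OPTIONS --safe #-}
module Submission where

open import Defs
open import Data.Nat as ℕ using (ℕ; zero; suc; _!; _≟_; _<_; _≤_; z≤n; s≤s)
open import Data.Nat.Properties using (_!≢0)
import Data.Integer as ℤ
import Data.Nat.Properties as ℕP
open import Data.Fin using (toℕ)
open import Data.Rational as ℚ using (ℚ; 0ℚ; 1ℚ; _+_; _*_)
import Data.Rational.Properties as ℚP
open import Data.List using (List; []; _∷_; _++_; map; concatMap; filter; replicate; upTo; applyUpTo; length)
open import Data.Bool.ListAction using (all)
import Data.List.Properties as LP
open import Data.Bool using (Bool; true; false; if_then_else_; _∧_)
import Data.Bool.Properties as BoolP
open import Data.Product using (_×_; _,_; proj₂)
open import Data.List.Relation.Unary.All as All using (All; []; _∷_)
import Data.List.Relation.Unary.All.Properties as AllP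
open import Data.List.Membership.Propositional using (_∈_)
open import Data.List.Relation.Unary.Any using (here; there)
import Data.List.Membership.Propositional.Properties as ∈P
open import Relation.Nullary.Decidable using (does; ⌊_⌋; yes; no; dec-false)
open import Data.Empty using (⊥-elim)
open import Relation.Binary.PropositionalEquality
open import Function using (_∘_)
open import Algebra.Bundles using (CommutativeRing)
open import Algebra.Properties.CommutativeSemigroup ℕP.+-commutativeSemigroup using () renaming (x∙yz≈y∙xz to +-left-comm)
open import Algebra.Properties.Semiring.Sum (CommutativeRing.semiring ℚP.+-*-commutativeRing)
  using (sum; sum-cong-≗; ∑-comm; *-distribˡ-sum; *-distribʳ-sum)
open import Data.Rational.Solver using (module +-*-Solver)
open +-*-Solver using (solve; _:=_; _:*_)
open ≡-Reasoning

sumℚ-++ : ∀ xs ys → sumℚ (xs ++ ys) ≡ sumℚ xs + sumℚ ys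
sumℚ-++ []       ys = sym (ℚP.+-identityˡ (sumℚ ys))
sumℚ-++ (x ∷ xs) ys = trans (cong (x +_) (sumℚ-++ xs ys)) (sym (ℚP.+-assoc x (sumℚ xs) (sumℚ ys)))

sumℚ-zero : ∀ xs → All (_≡ 0ℚ) xs → sumℚ xs ≡ 0ℚ
sumℚ-zero []       []            = refl
sumℚ-zero (x ∷ xs) (x≡0 ∷ xs≡0) = trans (cong₂ _+_ x≡0 (sumℚ-zero xs xs≡0)) (ℚP.+-identityˡ 0ℚ)

sumTo : ℕ → (ℕ → ℚ) → ℚ
sumTo n f = sumℚ (map f (upTo n))

infix 5 sumTo
syntax sumTo n (λ i → x) = Σ[ i < n ] x

sumTo-suc : ∀ n (f : ℕ → ℚ) → Σ[ i < suc n ] f i ≡ f 0 + (Σ[ i < n ] f (suc i))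
sumTo-suc n f = cong (λ xs → f 0 + sumℚ xs) (begin
  map f (applyUpTo suc n)        ≡⟨ LP.map-applyUpTo suc f n ⟩
  applyUpTo (f ∘ suc) n          ≡⟨ LP.map-upTo (f ∘ suc) n ⟨
  map (f ∘ suc) (upTo n)         ∎)

sumTo-+ : ∀ m n (f : ℕ → ℚ) → Σ[ i < m ℕ.+ n ] f i ≡ (Σ[ i < m ] f i) + (Σ[ i < n ] f (m ℕ.+ i))
sumTo-+ zero    n f = sym (ℚP.+-identityˡ _)
sumTo-+ (suc m) n f = begin
  Σ[ i < suc m ℕ.+ n ] f i
    ≡⟨ sumTo-suc (m ℕ.+ n) f ⟩
  f 0 + (Σ[ i < m ℕ.+ n ] f (suc i))
    ≡⟨ cong (f 0 +_) (sumTo-+ m n (f ∘ suc)) ⟩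
  f 0 + ((Σ[ i < m ] f (suc i)) + (Σ[ i < n ] f (suc m ℕ.+ i)))
    ≡⟨ ℚP.+-assoc (f 0) _ _ ⟨
  (f 0 + (Σ[ i < m ] f (suc i))) + (Σ[ i < n ] f (suc m ℕ.+ i))
    ≡⟨ cong (_+ (Σ[ i < n ] f (suc m ℕ.+ i))) (sumTo-suc m f) ⟨
  (Σ[ i < suc m ] f i) + (Σ[ i < n ] f (suc m ℕ.+ i)) ∎

sumTo-cong : ∀ n {f g : ℕ → ℚ} → (∀ i → i < n → f i ≡ g i) → Σ[ i < n ] f i ≡ Σ[ i < n ] g i
sumTo-cong zero    f≡g = refl
sumTo-cong (suc n) {f} {g} f≡g = begin
  Σ[ i < suc n ] f i               ≡⟨ sumTo-suc n f ⟩
  f 0 + (Σ[ i < n ] f (suc i))     ≡⟨ cong₂ _+_ (f≡g 0 (s≤s z≤n)) (sumTo-cong n (λ i i<n → f≡g (suc i) (s≤s i<n))) ⟩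
  g 0 + (Σ[ i < n ] g (suc i))     ≡⟨ sumTo-suc n g ⟨
  Σ[ i < suc n ] g i               ∎

sumTo-zero : ∀ n {f : ℕ → ℚ} → (∀ i → i < n → f i ≡ 0ℚ) → Σ[ i < n ] f i ≡ 0ℚ
sumTo-zero zero    f≡0 = refl
sumTo-zero (suc n) {f} f≡0 = begin
  Σ[ i < suc n ] f i               ≡⟨ sumTo-suc n f ⟩
  f 0 + (Σ[ i < n ] f (suc i))     ≡⟨ cong₂ _+_ (f≡0 0 (s≤s z≤n)) (sumTo-zero n (λ i i<n → f≡0 (suc i) (s≤s i<n))) ⟩
  0ℚ                               ∎

sumTo-single : ∀ n k {f : ℕ → ℚ} → k < n → (∀ i → i < n → i ≢ k → f i ≡ 0ℚ) → Σ[ i < n ] f i ≡ f k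
sumTo-single (suc n) zero {f} _ f≡0 = begin
  Σ[ i < suc n ] f i               ≡⟨ sumTo-suc n f ⟩
  f 0 + (Σ[ i < n ] f (suc i))     ≡⟨ cong (f 0 +_) (sumTo-zero n (λ i i<n → f≡0 (suc i) (s≤s i<n) (λ ()))) ⟩
  f 0 + 0ℚ                         ≡⟨ ℚP.+-identityʳ (f 0) ⟩
  f 0                              ∎
sumTo-single (suc n) (suc k) {f} (s≤s k<n) f≡0 = begin
  Σ[ i < suc n ] f i               ≡⟨ sumTo-suc n f ⟩
  f 0 + (Σ[ i < n ] f (suc i))     ≡⟨ cong₂ _+_ (f≡0 0 (s≤s z≤n) (λ ()))
                                         (sumTo-single n k k<n (λ i i<n i≢k → f≡0 (suc i) (s≤s i<n) (i≢k ∘ ℕP.suc-injective))) ⟩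
  0ℚ + f (suc k)                   ≡⟨ ℚP.+-identityˡ _ ⟩
  f (suc k)                        ∎

sumTo-extend : ∀ {m n} {f : ℕ → ℚ} → m ≤ n → (∀ i → m ≤ i → i < n → f i ≡ 0ℚ) →
               Σ[ i < m ] f i ≡ Σ[ i < n ] f i
sumTo-extend {m} {n} {f} m≤n f≡0 = begin
  Σ[ i < m ] f i                                    ≡⟨ ℚP.+-identityʳ (Σ[ i < m ] f i) ⟨
  (Σ[ i < m ] f i) + 0ℚ                             ≡⟨ cong ((Σ[ i < m ] f i) +_) (sumTo-zero k tail≡0) ⟨
  (Σ[ i < m ] f i) + (Σ[ i < k ] f (m ℕ.+ i))       ≡⟨ sumTo-+ m k f ⟨
  Σ[ i < m ℕ.+ k ] f i                              ≡⟨ cong (λ l → Σ[ i < l ] f i) (ℕP.m+[n∸m]≡n m≤n) ⟩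
  Σ[ i < n ] f i                                    ∎
  where
  k = n ℕ.∸ m
  tail≡0 : ∀ i → i < k → f (m ℕ.+ i) ≡ 0ℚ
  tail≡0 i i<k = f≡0 (m ℕ.+ i) (ℕP.m≤m+n m i) (subst (m ℕ.+ i <_) (ℕP.m+[n∸m]≡n m≤n) (ℕP.+-monoʳ-< m i<k))

sumTo-sum : ∀ n (f : ℕ → ℚ) → Σ[ i < n ] f i ≡ sum {n} (f ∘ toℕ)
sumTo-sum zero    f = refl
sumTo-sum (suc n) f = trans (sumTo-suc n f) (cong (f 0 +_) (sumTo-sum n (f ∘ suc)))

sumTo-sum₂ : ∀ m n (f : ℕ → ℕ → ℚ) →
             Σ[ i < m ] Σ[ j < n ] f i j ≡ sum {m} (λ i → sum {n} (λ j → f (toℕ i) (toℕ j)))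
sumTo-sum₂ m n f = trans (sumTo-sum m (λ i → Σ[ j < n ] f i j)) (sum-cong-≗ {m} (λ i → sumTo-sum n (f (toℕ i))))

sumTo-comm : ∀ m n (f : ℕ → ℕ → ℚ) → Σ[ i < m ] Σ[ j < n ] f i j ≡ Σ[ j < n ] Σ[ i < m ] f i j
sumTo-comm m n f = begin
  Σ[ i < m ] Σ[ j < n ] f i j   ≡⟨ sumTo-sum₂ m n f ⟩
  _                             ≡⟨ ∑-comm {m} {n} (λ i j → f (toℕ i) (toℕ j)) ⟩
  _                             ≡⟨ sumTo-sum₂ n m (λ j i → f i j) ⟨
  Σ[ j < n ] Σ[ i < m ] f i j   ∎

*-distribˡ-sumTo : ∀ n c (f : ℕ → ℚ) → c * (Σ[ i < n ] f i) ≡ Σ[ i < n ] c * f i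
*-distribˡ-sumTo n c f =
  trans (cong (c *_) (sumTo-sum n f)) (trans (*-distribˡ-sum {n} c _) (sym (sumTo-sum n _)))

*-distribʳ-sumTo : ∀ n c (f : ℕ → ℚ) → (Σ[ i < n ] f i) * c ≡ Σ[ i < n ] f i * c
*-distribʳ-sumTo n c f =
  trans (cong (_* c) (sumTo-sum n f)) (trans (*-distribʳ-sum {n} c _) (sym (sumTo-sum n _)))

*-distribˡ-sumTo₂ : ∀ N c (F : ℕ → ℕ → ℚ) → c * (Σ[ i < N ] Σ[ j < N ] F i j) ≡ Σ[ i < N ] Σ[ j < N ] c * F i j
*-distribˡ-sumTo₂ N c F =
  trans (*-distribˡ-sumTo N c (λ i → Σ[ j < N ] F i j)) (sumTo-cong N (λ i _ → *-distribˡ-sumTo N c (F i)))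

*-distribʳ-sumTo₂ : ∀ N c (F : ℕ → ℕ → ℚ) → (Σ[ i < N ] Σ[ j < N ] F i j) * c ≡ Σ[ i < N ] Σ[ j < N ] F i j * c
*-distribʳ-sumTo₂ N c F =
  trans (*-distribʳ-sumTo N c (λ i → Σ[ j < N ] F i j)) (sumTo-cong N (λ i _ → *-distribʳ-sumTo N c (F i)))

sumTo-*-sumTo : ∀ N (f g : ℕ → ℚ) → (Σ[ i < N ] f i) * (Σ[ j < N ] g j) ≡ Σ[ i < N ] Σ[ j < N ] f i * g j
sumTo-*-sumTo N f g =
  trans (*-distribʳ-sumTo N (Σ[ j < N ] g j) f) (sumTo-cong N (λ i _ → *-distribˡ-sumTo N (f i) g))

sumTo-comm₂₂ : ∀ N (F : ℕ → ℕ → ℕ → ℕ → ℚ) →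
  Σ[ a < N ] Σ[ b < N ] Σ[ i < N ] Σ[ j < N ] F a b i j ≡ Σ[ i < N ] Σ[ j < N ] Σ[ a < N ] Σ[ b < N ] F a b i j
sumTo-comm₂₂ N F = begin
  Σ[ a < N ] Σ[ b < N ] Σ[ i < N ] Σ[ j < N ] F a b i j
    ≡⟨ sumTo-cong N (λ a _ → sumTo-comm N N (λ b i → Σ[ j < N ] F a b i j)) ⟩
  Σ[ a < N ] Σ[ i < N ] Σ[ b < N ] Σ[ j < N ] F a b i j
    ≡⟨ sumTo-comm N N (λ a i → Σ[ b < N ] Σ[ j < N ] F a b i j) ⟩
  Σ[ i < N ] Σ[ a < N ] Σ[ b < N ] Σ[ j < N ] F a b i j
    ≡⟨ sumTo-cong N (λ i _ → sumTo-cong N (λ a _ → sumTo-comm N N (λ b j → F a b i j))) ⟩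
  Σ[ i < N ] Σ[ a < N ] Σ[ j < N ] Σ[ b < N ] F a b i j
    ≡⟨ sumTo-cong N (λ i _ → sumTo-comm N N (λ a j → Σ[ b < N ] F a b i j)) ⟩
  Σ[ i < N ] Σ[ j < N ] Σ[ a < N ] Σ[ b < N ] F a b i j ∎

δ : ℕ → ℕ → ℚ
δ a b = if ⌊ a ≟ b ⌋ then 1ℚ else 0ℚ

δ-refl : ∀ a → δ a a ≡ 1ℚ
δ-refl a with a ≟ a
... | yes _  = refl
... | no a≢a = ⊥-elim (a≢a refl)

δ-≢ : ∀ {a b} → a ≢ b → δ a b ≡ 0ℚ
δ-≢ {a} {b} a≢b with a ≟ b
... | yes a≡b = ⊥-elim (a≢b a≡b)
... | no _    = refl

δ-sym : ∀ a b → δ a b ≡ δ b a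
δ-sym a b with a ≟ b
... | yes refl = sym (δ-refl a)
... | no a≢b   = sym (δ-≢ (a≢b ∘ sym))

δ-suc : ∀ a b → δ (suc a) (suc b) ≡ δ a b
δ-suc a b with a ≟ b
... | yes refl = δ-refl (suc a)
... | no a≢b   = δ-≢ (a≢b ∘ ℕP.suc-injective)

δ-refl-* : ∀ a x → δ a a * x ≡ x
δ-refl-* a x = trans (cong (_* x) (δ-refl a)) (ℚP.*-identityˡ x)

δ-≢-* : ∀ {a b} → a ≢ b → ∀ x → δ a b * x ≡ 0ℚ
δ-≢-* a≢b x = trans (cong (_* x) (δ-≢ a≢b)) (ℚP.*-zeroˡ x)

sumTo-δ : ∀ n m (f : ℕ → ℚ) → (n ≤ m → f m ≡ 0ℚ) → Σ[ a < n ] δ m a * f a ≡ f m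
sumTo-δ n m f fm≡0 with m ℕ.<? n
... | yes m<n = trans (sumTo-single n m m<n (λ a _ a≢m → δ-≢-* (a≢m ∘ sym) (f a))) (δ-refl-* m (f m))
... | no  m≮n =
  trans (sumTo-zero n (λ a a<n → δ-≢-* {m} {a} (λ { refl → m≮n a<n }) (f a))) (sym (fm≡0 (ℕP.≮⇒≥ m≮n)))

-- Formal power series

mulP-cong : ∀ {f f′ g g′} → f ≗ f′ → g ≗ g′ → mulP f g ≗ mulP f′ g′
mulP-cong f≗f′ g≗g′ n = sumTo-cong (suc n) (λ i _ → cong₂ _*_ (f≗f′ i) (g≗g′ (n ℕ.∸ i)))

powP-cong : ∀ {f f′} → f ≗ f′ → ∀ k → powP f k ≗ powP f′ k
powP-cong f≗f′ zero    = λ _ → refl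
powP-cong f≗f′ (suc k) = mulP-cong f≗f′ (powP-cong f≗f′ k)

compP-cong : ∀ {f f′ g g′} → f ≗ f′ → g ≗ g′ → compP f g ≗ compP f′ g′
compP-cong f≗f′ g≗g′ n = sumTo-cong (suc n) (λ k _ → cong₂ _*_ (f≗f′ k) (powP-cong g≗g′ k n))

-- Spreading a convolution over a full square with a Kronecker delta turns every reindexing
-- below into an interchange of finite sums.
mulP-δ-sum : ∀ {N n} f g → n < N → mulP f g n ≡ Σ[ i < N ] Σ[ j < N ] δ (i ℕ.+ j) n * (f i * g j)
mulP-δ-sum {N} {n} f g n<N = begin
  Σ[ i < suc n ] f i * g (n ℕ.∸ i)
    ≡⟨ sumTo-cong (suc n) (λ i i≤n → sym (inner i (ℕP.≤-pred i≤n))) ⟩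
  Σ[ i < suc n ] Σ[ j < N ] δ (i ℕ.+ j) n * (f i * g j)
    ≡⟨ sumTo-extend n<N (λ i n<i _ → sumTo-zero N (λ j _ →
         δ-≢-* (ℕP.>⇒≢ (ℕP.<-≤-trans n<i (ℕP.m≤m+n i j))) (f i * g j))) ⟩
  Σ[ i < N ] Σ[ j < N ] δ (i ℕ.+ j) n * (f i * g j) ∎
  where
  inner : ∀ i → i ≤ n → Σ[ j < N ] δ (i ℕ.+ j) n * (f i * g j) ≡ f i * g (n ℕ.∸ i)
  inner i i≤n = begin
    Σ[ j < N ] δ (i ℕ.+ j) n * (f i * g j)
      ≡⟨ sumTo-single N (n ℕ.∸ i) (ℕP.≤-<-trans (ℕP.m∸n≤m n i) n<N)
           (λ j _ j≢n-i → δ-≢-* (λ i+j≡n → j≢n-i (trans (sym (ℕP.m+n∸m≡n i j)) (cong (ℕ._∸ i) i+j≡n)))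
                                (f i * g j)) ⟩
    δ (i ℕ.+ (n ℕ.∸ i)) n * (f i * g (n ℕ.∸ i))
      ≡⟨ cong (λ m → δ m n * (f i * g (n ℕ.∸ i))) (ℕP.m+[n∸m]≡n i≤n) ⟩
    δ n n * (f i * g (n ℕ.∸ i))
      ≡⟨ δ-refl-* n _ ⟩
    f i * g (n ℕ.∸ i) ∎

mulP-assoc-expandˡ : ∀ n f g k → mulP (mulP f g) k n ≡
  Σ[ i < suc n ] Σ[ j < suc n ] Σ[ b < suc n ] δ (i ℕ.+ j ℕ.+ b) n * (f i * (g j * k b))
mulP-assoc-expandˡ n f g k = begin
  mulP (mulP f g) k n
    ≡⟨ mulP-δ-sum (mulP f g) k ℕP.≤-refl ⟩
  Σ[ a < N ] Σ[ b < N ] δ (a ℕ.+ b) n * (mulP f g a * k b)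
    ≡⟨ sumTo-cong N (λ a a<N → sumTo-cong N (λ b _ → expand a b a<N)) ⟩
  Σ[ a < N ] Σ[ b < N ] Σ[ i < N ] Σ[ j < N ] δ (i ℕ.+ j) a * (δ (a ℕ.+ b) n * X i j b)
    ≡⟨ sumTo-comm₂₂ N (λ a b i j → δ (i ℕ.+ j) a * (δ (a ℕ.+ b) n * X i j b)) ⟩
  Σ[ i < N ] Σ[ j < N ] Σ[ a < N ] Σ[ b < N ] δ (i ℕ.+ j) a * (δ (a ℕ.+ b) n * X i j b)
    ≡⟨ sumTo-cong N (λ i _ → sumTo-cong N (λ j _ → sumTo-cong N (λ a _ →
         sym (*-distribˡ-sumTo N (δ (i ℕ.+ j) a) (λ b → δ (a ℕ.+ b) n * X i j b))))) ⟩
  Σ[ i < N ] Σ[ j < N ] Σ[ a < N ] δ (i ℕ.+ j) a * (Σ[ b < N ] δ (a ℕ.+ b) n * X i j b)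
    ≡⟨ sumTo-cong N (λ i _ → sumTo-cong N (λ j _ → sumTo-δ N (i ℕ.+ j) (λ a → Σ[ b < N ] δ (a ℕ.+ b) n * X i j b)
         (λ N≤i+j → sumTo-zero N (λ b _ → δ-≢-* (ℕP.>⇒≢ (ℕP.≤-trans N≤i+j (ℕP.m≤m+n (i ℕ.+ j) b))) (X i j b))))) ⟩
  Σ[ i < N ] Σ[ j < N ] Σ[ b < N ] δ (i ℕ.+ j ℕ.+ b) n * X i j b ∎
  where
  N = suc n
  X : ℕ → ℕ → ℕ → ℚ
  X i j b = f i * (g j * k b)
  expand : ∀ a b → a < N →
    δ (a ℕ.+ b) n * (mulP f g a * k b) ≡ Σ[ i < N ] Σ[ j < N ] δ (i ℕ.+ j) a * (δ (a ℕ.+ b) n * X i j b)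
  expand a b a<N = begin
    δ (a ℕ.+ b) n * (mulP f g a * k b)
      ≡⟨ cong (λ x → δ (a ℕ.+ b) n * (x * k b)) (mulP-δ-sum f g a<N) ⟩
    δ (a ℕ.+ b) n * ((Σ[ i < N ] Σ[ j < N ] δ (i ℕ.+ j) a * (f i * g j)) * k b)
      ≡⟨ cong (δ (a ℕ.+ b) n *_) (*-distribʳ-sumTo₂ N (k b) (λ i j → δ (i ℕ.+ j) a * (f i * g j))) ⟩
    δ (a ℕ.+ b) n * (Σ[ i < N ] Σ[ j < N ] δ (i ℕ.+ j) a * (f i * g j) * k b)
      ≡⟨ *-distribˡ-sumTo₂ N (δ (a ℕ.+ b) n) (λ i j → δ (i ℕ.+ j) a * (f i * g j) * k b) ⟩
    Σ[ i < N ] Σ[ j < N ] δ (a ℕ.+ b) n * (δ (i ℕ.+ j) a * (f i * g j) * k b)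
      ≡⟨ sumTo-cong N (λ i _ → sumTo-cong N (λ j _ → rearrange (δ (a ℕ.+ b) n) (δ (i ℕ.+ j) a) (f i) (g j) (k b))) ⟩
    Σ[ i < N ] Σ[ j < N ] δ (i ℕ.+ j) a * (δ (a ℕ.+ b) n * X i j b) ∎
    where
    rearrange : ∀ x y p q r → x * (y * (p * q) * r) ≡ y * (x * (p * (q * r)))
    rearrange = solve 5 (λ x y p q r → x :* (y :* (p :* q) :* r) := y :* (x :* (p :* (q :* r)))) refl

mulP-assoc-expandʳ : ∀ n f g k → mulP f (mulP g k) n ≡
  Σ[ i < suc n ] Σ[ j < suc n ] Σ[ b < suc n ] δ (i ℕ.+ j ℕ.+ b) n * (f i * (g j * k b))
mulP-assoc-expandʳ n f g k = begin
  mulP f (mulP g k) n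
    ≡⟨ mulP-δ-sum f (mulP g k) ℕP.≤-refl ⟩
  Σ[ i < N ] Σ[ c < N ] δ (i ℕ.+ c) n * (f i * mulP g k c)
    ≡⟨ sumTo-cong N (λ i _ → sumTo-cong N (λ c c<N → expand i c c<N)) ⟩
  Σ[ i < N ] Σ[ c < N ] Σ[ j < N ] Σ[ b < N ] δ (j ℕ.+ b) c * (δ (i ℕ.+ c) n * X i j b)
    ≡⟨ sumTo-cong N (λ i _ → sumTo-comm N N (λ c j → Σ[ b < N ] δ (j ℕ.+ b) c * (δ (i ℕ.+ c) n * X i j b))) ⟩
  Σ[ i < N ] Σ[ j < N ] Σ[ c < N ] Σ[ b < N ] δ (j ℕ.+ b) c * (δ (i ℕ.+ c) n * X i j b)
    ≡⟨ sumTo-cong N (λ i _ → sumTo-cong N (λ j _ → sumTo-comm N N (λ c b → δ (j ℕ.+ b) c * (δ (i ℕ.+ c) n * X i j b)))) ⟩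
  Σ[ i < N ] Σ[ j < N ] Σ[ b < N ] Σ[ c < N ] δ (j ℕ.+ b) c * (δ (i ℕ.+ c) n * X i j b)
    ≡⟨ sumTo-cong N (λ i _ → sumTo-cong N (λ j _ → sumTo-cong N (λ b _ → collapse i j b))) ⟩
  Σ[ i < N ] Σ[ j < N ] Σ[ b < N ] δ (i ℕ.+ j ℕ.+ b) n * X i j b ∎
  where
  N = suc n
  X : ℕ → ℕ → ℕ → ℚ
  X i j b = f i * (g j * k b)
  collapse : ∀ i j b → Σ[ c < N ] δ (j ℕ.+ b) c * (δ (i ℕ.+ c) n * X i j b) ≡ δ (i ℕ.+ j ℕ.+ b) n * X i j b
  collapse i j b = begin
    Σ[ c < N ] δ (j ℕ.+ b) c * (δ (i ℕ.+ c) n * X i j b)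
      ≡⟨ sumTo-δ N (j ℕ.+ b) (λ c → δ (i ℕ.+ c) n * X i j b)
           (λ N≤j+b → δ-≢-* (ℕP.>⇒≢ (ℕP.≤-trans N≤j+b (ℕP.m≤n+m (j ℕ.+ b) i))) (X i j b)) ⟩
    δ (i ℕ.+ (j ℕ.+ b)) n * X i j b
      ≡⟨ cong (λ m → δ m n * X i j b) (ℕP.+-assoc i j b) ⟨
    δ (i ℕ.+ j ℕ.+ b) n * X i j b ∎
  expand : ∀ i c → c < N →
    δ (i ℕ.+ c) n * (f i * mulP g k c) ≡ Σ[ j < N ] Σ[ b < N ] δ (j ℕ.+ b) c * (δ (i ℕ.+ c) n * X i j b)
  expand i c c<N = begin
    δ (i ℕ.+ c) n * (f i * mulP g k c)
      ≡⟨ cong (λ x → δ (i ℕ.+ c) n * (f i * x)) (mulP-δ-sum g k c<N) ⟩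
    δ (i ℕ.+ c) n * (f i * (Σ[ j < N ] Σ[ b < N ] δ (j ℕ.+ b) c * (g j * k b)))
      ≡⟨ cong (δ (i ℕ.+ c) n *_) (*-distribˡ-sumTo₂ N (f i) (λ j b → δ (j ℕ.+ b) c * (g j * k b))) ⟩
    δ (i ℕ.+ c) n * (Σ[ j < N ] Σ[ b < N ] f i * (δ (j ℕ.+ b) c * (g j * k b)))
      ≡⟨ *-distribˡ-sumTo₂ N (δ (i ℕ.+ c) n) (λ j b → f i * (δ (j ℕ.+ b) c * (g j * k b))) ⟩
    Σ[ j < N ] Σ[ b < N ] δ (i ℕ.+ c) n * (f i * (δ (j ℕ.+ b) c * (g j * k b)))
      ≡⟨ sumTo-cong N (λ j _ → sumTo-cong N (λ b _ → rearrange (δ (i ℕ.+ c) n) (δ (j ℕ.+ b) c) (f i) (g j) (k b))) ⟩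
    Σ[ j < N ] Σ[ b < N ] δ (j ℕ.+ b) c * (δ (i ℕ.+ c) n * X i j b) ∎
    where
    rearrange : ∀ x y p q r → x * (p * (y * (q * r))) ≡ y * (x * (p * (q * r)))
    rearrange = solve 5 (λ x y p q r → x :* (p :* (y :* (q :* r))) := y :* (x :* (p :* (q :* r)))) refl

mulP-assoc : ∀ f g k → mulP (mulP f g) k ≗ mulP f (mulP g k)
mulP-assoc f g k n = trans (mulP-assoc-expandˡ n f g k) (sym (mulP-assoc-expandʳ n f g k))

mulP-identityˡ : ∀ g → mulP oneP g ≗ g
mulP-identityˡ g n = trans (sumTo-single (suc n) 0 (s≤s z≤n) vanish) (ℚP.*-identityˡ (g n))
  where
  vanish : ∀ j → j < suc n → j ≢ 0 → oneP j * g (n ℕ.∸ j) ≡ 0ℚ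
  vanish zero    _ 0≢0 = ⊥-elim (0≢0 refl)
  vanish (suc j) _ _   = ℚP.*-zeroˡ (g (n ℕ.∸ suc j))

mulP-identityʳ : ∀ f → mulP f oneP ≗ f
mulP-identityʳ f n = begin
  mulP f oneP n           ≡⟨ sumTo-single (suc n) n ℕP.≤-refl vanish ⟩
  f n * oneP (n ℕ.∸ n)    ≡⟨ cong (λ m → f n * oneP m) (ℕP.n∸n≡0 n) ⟩
  f n * 1ℚ                ≡⟨ ℚP.*-identityʳ (f n) ⟩
  f n                     ∎
  where
  vanish : ∀ j → j < suc n → j ≢ n → f j * oneP (n ℕ.∸ j) ≡ 0ℚ
  vanish j j≤n j≢n with n ℕ.∸ j in n∸j≡
  ... | zero  = ⊥-elim (j≢n (ℕP.≤-antisym (ℕP.≤-pred j≤n) (ℕP.m∸n≡0⇒m≤n n∸j≡)))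
  ... | suc _ = ℚP.*-zeroʳ (f j)

powP-+ : ∀ h i j → powP h (i ℕ.+ j) ≗ mulP (powP h i) (powP h j)
powP-+ h zero    j n = sym (mulP-identityˡ (powP h j) n)
powP-+ h (suc i) j n = trans (mulP-cong {h} (λ _ → refl) (powP-+ h i j) n) (sym (mulP-assoc h (powP h i) (powP h j) n))

mulP-zeroˡ : ∀ f g → (∀ i → f i ≡ 0ℚ) → ∀ n → mulP f g n ≡ 0ℚ
mulP-zeroˡ f g f≡0 n =
  sumTo-zero (suc n) (λ i _ → trans (cong (_* g (n ℕ.∸ i)) (f≡0 i)) (ℚP.*-zeroˡ (g (n ℕ.∸ i))))

powP-vanishes : ∀ h → h 0 ≡ 0ℚ → ∀ k n → n < k → powP h k n ≡ 0ℚ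
powP-vanishes h h0≡0 (suc k) n (s≤s n≤k) = sumTo-zero (suc n) vanish
  where
  vanish : ∀ i → i < suc n → h i * powP h k (n ℕ.∸ i) ≡ 0ℚ
  vanish zero    _         = trans (cong (_* powP h k n) h0≡0) (ℚP.*-zeroˡ (powP h k n))
  vanish (suc i) (s≤s i<n) = trans (cong (h (suc i) *_) (powP-vanishes h h0≡0 k (n ℕ.∸ suc i)
      (ℕP.<-≤-trans (ℕP.∸-monoʳ-< {n} {suc i} {0} (s≤s z≤n) i<n) n≤k))) (ℚP.*-zeroʳ (h (suc i)))

compP-extend : ∀ {N n} f h → h 0 ≡ 0ℚ → n < N → compP f h n ≡ Σ[ k < N ] f k * powP h k n
compP-extend f h h0≡0 n<N =
  sumTo-extend n<N (λ k n<k _ → trans (cong (f k *_) (powP-vanishes h h0≡0 k _ n<k)) (ℚP.*-zeroʳ (f k)))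

compP-mulP-expand : ∀ n f g h → h 0 ≡ 0ℚ →
  compP (mulP f g) h n ≡ Σ[ i < suc n ] Σ[ j < suc n ] f i * g j * powP h (i ℕ.+ j) n
compP-mulP-expand n f g h h0≡0 = begin
  Σ[ k < N ] mulP f g k * P k n
    ≡⟨ sumTo-cong N (λ k k<N → cong (_* P k n) (mulP-δ-sum f g k<N)) ⟩
  Σ[ k < N ] (Σ[ i < N ] Σ[ j < N ] δ (i ℕ.+ j) k * (f i * g j)) * P k n
    ≡⟨ sumTo-cong N (λ k _ → *-distribʳ-sumTo₂ N (P k n) (λ i j → δ (i ℕ.+ j) k * (f i * g j))) ⟩
  Σ[ k < N ] Σ[ i < N ] Σ[ j < N ] δ (i ℕ.+ j) k * (f i * g j) * P k n
    ≡⟨ sumTo-comm N N (λ k i → Σ[ j < N ] δ (i ℕ.+ j) k * (f i * g j) * P k n) ⟩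
  Σ[ i < N ] Σ[ k < N ] Σ[ j < N ] δ (i ℕ.+ j) k * (f i * g j) * P k n
    ≡⟨ sumTo-cong N (λ i _ → sumTo-comm N N (λ k j → δ (i ℕ.+ j) k * (f i * g j) * P k n)) ⟩
  Σ[ i < N ] Σ[ j < N ] Σ[ k < N ] δ (i ℕ.+ j) k * (f i * g j) * P k n
    ≡⟨ sumTo-cong N (λ i _ → sumTo-cong N (λ j _ → collapse i j)) ⟩
  Σ[ i < N ] Σ[ j < N ] f i * g j * P (i ℕ.+ j) n ∎
  where
  N = suc n
  P = powP h
  collapse : ∀ i j → Σ[ k < N ] δ (i ℕ.+ j) k * (f i * g j) * P k n ≡ f i * g j * P (i ℕ.+ j) n
  collapse i j = begin
    Σ[ k < N ] δ (i ℕ.+ j) k * (f i * g j) * P k n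
      ≡⟨ sumTo-cong N (λ k _ → ℚP.*-assoc (δ (i ℕ.+ j) k) (f i * g j) (P k n)) ⟩
    Σ[ k < N ] δ (i ℕ.+ j) k * (f i * g j * P k n)
      ≡⟨ sumTo-δ N (i ℕ.+ j) (λ k → f i * g j * P k n)
           (λ N≤i+j → trans (cong (f i * g j *_) (powP-vanishes h h0≡0 (i ℕ.+ j) n N≤i+j))
                            (ℚP.*-zeroʳ (f i * g j))) ⟩
    f i * g j * P (i ℕ.+ j) n ∎

mulP-compP-expand : ∀ n f g h → h 0 ≡ 0ℚ →
  mulP (compP f h) (compP g h) n ≡ Σ[ i < suc n ] Σ[ j < suc n ] f i * g j * powP h (i ℕ.+ j) n
mulP-compP-expand n f g h h0≡0 = begin
  mulP (compP f h) (compP g h) n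
    ≡⟨ mulP-δ-sum {n = n} (compP f h) (compP g h) ℕP.≤-refl ⟩
  Σ[ a < N ] Σ[ b < N ] δ (a ℕ.+ b) n * (compP f h a * compP g h b)
    ≡⟨ sumTo-cong N (λ a a<N → sumTo-cong N (λ b b<N → expand a b a<N b<N)) ⟩
  Σ[ a < N ] Σ[ b < N ] Σ[ i < N ] Σ[ j < N ] δ (a ℕ.+ b) n * (f i * P i a * (g j * P j b))
    ≡⟨ sumTo-comm₂₂ N (λ a b i j → δ (a ℕ.+ b) n * (f i * P i a * (g j * P j b))) ⟩
  Σ[ i < N ] Σ[ j < N ] Σ[ a < N ] Σ[ b < N ] δ (a ℕ.+ b) n * (f i * P i a * (g j * P j b))
    ≡⟨ sumTo-cong N (λ i _ → sumTo-cong N (λ j _ → sumTo-cong N (λ a _ → sumTo-cong N (λ b _ →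
         rearrange (δ (a ℕ.+ b) n) (f i) (P i a) (g j) (P j b))))) ⟩
  Σ[ i < N ] Σ[ j < N ] Σ[ a < N ] Σ[ b < N ] f i * g j * (δ (a ℕ.+ b) n * (P i a * P j b))
    ≡⟨ sumTo-cong N (λ i _ → sumTo-cong N (λ j _ →
         sym (*-distribˡ-sumTo₂ N (f i * g j) (λ a b → δ (a ℕ.+ b) n * (P i a * P j b))))) ⟩
  Σ[ i < N ] Σ[ j < N ] f i * g j * (Σ[ a < N ] Σ[ b < N ] δ (a ℕ.+ b) n * (P i a * P j b))
    ≡⟨ sumTo-cong N (λ i _ → sumTo-cong N (λ j _ → cong (f i * g j *_)
         (trans (sym (mulP-δ-sum {n = n} (P i) (P j) ℕP.≤-refl)) (sym (powP-+ h i j n))))) ⟩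
  Σ[ i < N ] Σ[ j < N ] f i * g j * P (i ℕ.+ j) n ∎
  where
  N = suc n
  P = powP h
  rearrange : ∀ d x p y q → d * (x * p * (y * q)) ≡ x * y * (d * (p * q))
  rearrange = solve 5 (λ d x p y q → d :* (x :* p :* (y :* q)) := x :* y :* (d :* (p :* q))) refl
  expand : ∀ a b → a < N → b < N → δ (a ℕ.+ b) n * (compP f h a * compP g h b) ≡
    Σ[ i < N ] Σ[ j < N ] δ (a ℕ.+ b) n * (f i * P i a * (g j * P j b))
  expand a b a<N b<N = begin
    δ (a ℕ.+ b) n * (compP f h a * compP g h b)
      ≡⟨ cong (δ (a ℕ.+ b) n *_) (cong₂ _*_ (compP-extend f h h0≡0 a<N) (compP-extend g h h0≡0 b<N)) ⟩
    δ (a ℕ.+ b) n * ((Σ[ i < N ] f i * P i a) * (Σ[ j < N ] g j * P j b))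
      ≡⟨ cong (δ (a ℕ.+ b) n *_) (sumTo-*-sumTo N (λ i → f i * P i a) (λ j → g j * P j b)) ⟩
    δ (a ℕ.+ b) n * (Σ[ i < N ] Σ[ j < N ] f i * P i a * (g j * P j b))
      ≡⟨ *-distribˡ-sumTo₂ N (δ (a ℕ.+ b) n) (λ i j → f i * P i a * (g j * P j b)) ⟩
    Σ[ i < N ] Σ[ j < N ] δ (a ℕ.+ b) n * (f i * P i a * (g j * P j b)) ∎

compP-mulP : ∀ f g h → h 0 ≡ 0ℚ → compP (mulP f g) h ≗ mulP (compP f h) (compP g h)
compP-mulP f g h h0≡0 n = trans (compP-mulP-expand n f g h h0≡0) (sym (mulP-compP-expand n f g h h0≡0))

compP-oneP : ∀ h → compP oneP h ≗ oneP
compP-oneP h n = trans (sumTo-single (suc n) 0 (s≤s z≤n) vanish) (ℚP.*-identityˡ (powP h 0 n))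
  where
  vanish : ∀ k → k < suc n → k ≢ 0 → oneP k * powP h k n ≡ 0ℚ
  vanish zero    _ 0≢0 = ⊥-elim (0≢0 refl)
  vanish (suc k) _ _   = ℚP.*-zeroˡ (powP h (suc k) n)

compP-powP : ∀ g h → h 0 ≡ 0ℚ → ∀ i → compP (powP g i) h ≗ powP (compP g h) i
compP-powP g h h0≡0 zero    = compP-oneP h
compP-powP g h h0≡0 (suc i) n =
  trans (compP-mulP g (powP g i) h h0≡0 n) (mulP-cong {compP g h} (λ _ → refl) (compP-powP g h h0≡0 i) n)

compP-assoc : ∀ f g h → g 0 ≡ 0ℚ → h 0 ≡ 0ℚ → compP (compP f g) h ≗ compP f (compP g h)
compP-assoc f g h g0≡0 h0≡0 n = begin
  Σ[ k < N ] compP f g k * powP h k n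
    ≡⟨ sumTo-cong N (λ k k<N → cong (_* powP h k n) (compP-extend f g g0≡0 k<N)) ⟩
  Σ[ k < N ] (Σ[ i < N ] f i * powP g i k) * powP h k n
    ≡⟨ sumTo-cong N (λ k _ → *-distribʳ-sumTo N (powP h k n) (λ i → f i * powP g i k)) ⟩
  Σ[ k < N ] Σ[ i < N ] f i * powP g i k * powP h k n
    ≡⟨ sumTo-comm N N (λ k i → f i * powP g i k * powP h k n) ⟩
  Σ[ i < N ] Σ[ k < N ] f i * powP g i k * powP h k n
    ≡⟨ sumTo-cong N (λ i _ → sumTo-cong N (λ k _ → ℚP.*-assoc (f i) (powP g i k) (powP h k n))) ⟩
  Σ[ i < N ] Σ[ k < N ] f i * (powP g i k * powP h k n)
    ≡⟨ sumTo-cong N (λ i _ → sym (*-distribˡ-sumTo N (f i) (λ k → powP g i k * powP h k n))) ⟩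
  Σ[ i < N ] f i * compP (powP g i) h n
    ≡⟨ sumTo-cong N (λ i _ → cong (f i *_) (compP-powP g h h0≡0 i n)) ⟩
  Σ[ i < N ] f i * powP (compP g h) i n ∎
  where N = suc n

compP-constant : ∀ f g → f 0 ≡ 0ℚ → compP f g 0 ≡ 0ℚ
compP-constant f g f0≡0 = cong (λ x → x * powP g 0 0 + 0ℚ) f0≡0

idP : PS
idP 1 = 1ℚ
idP _ = 0ℚ

mulP-idP : ∀ g n → mulP idP g (suc n) ≡ g n
mulP-idP g n = trans (sumTo-single (suc (suc n)) 1 (s≤s (s≤s z≤n)) vanish) (ℚP.*-identityˡ (g n))
  where
  vanish : ∀ j → j < suc (suc n) → j ≢ 1 → idP j * g (suc n ℕ.∸ j) ≡ 0ℚ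
  vanish zero          _ _   = ℚP.*-zeroˡ (g (suc n))
  vanish (suc zero)    _ 1≢1 = ⊥-elim (1≢1 refl)
  vanish (suc (suc j)) _ _   = ℚP.*-zeroˡ (g (n ℕ.∸ suc j))

powP-idP : ∀ k n → powP idP k n ≡ δ k n
powP-idP zero    zero    = sym (δ-refl 0)
powP-idP zero    (suc n) = sym (δ-≢ {0} {suc n} (λ ()))
powP-idP (suc k) zero    =
  trans (ℚP.+-identityʳ _) (trans (ℚP.*-zeroˡ (powP idP k 0)) (sym (δ-≢ {suc k} {0} (λ ()))))
powP-idP (suc k) (suc n) = trans (mulP-idP (powP idP k) n) (trans (powP-idP k n) (sym (δ-suc k n)))

compP-idʳ : ∀ f → compP f idP ≗ f
compP-idʳ f n = begin
  Σ[ k < suc n ] f k * powP idP k n    ≡⟨ sumTo-cong (suc n) (λ k _ → cong (f k *_) (powP-idP k n)) ⟩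
  Σ[ k < suc n ] f k * δ k n           ≡⟨ sumTo-cong (suc n) (λ k _ → trans (ℚP.*-comm (f k) _) (cong (_* f k) (δ-sym k n))) ⟩
  Σ[ k < suc n ] δ n k * f k           ≡⟨ sumTo-δ (suc n) n f (λ n<n → ⊥-elim (ℕP.<-irrefl refl n<n)) ⟩
  f n                                  ∎

compP-idˡ : ∀ h → h 0 ≡ 0ℚ → compP idP h ≗ h
compP-idˡ h h0≡0 zero    = trans (compP-constant idP h refl) (sym h0≡0)
compP-idˡ h h0≡0 (suc n) = begin
  Σ[ k < suc (suc n) ] idP k * powP h k (suc n)
    ≡⟨ sumTo-single (suc (suc n)) 1 (s≤s (s≤s z≤n)) vanish ⟩
  1ℚ * mulP h oneP (suc n)     ≡⟨ ℚP.*-identityˡ _ ⟩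
  mulP h oneP (suc n)          ≡⟨ mulP-identityʳ h (suc n) ⟩
  h (suc n)                    ∎
  where
  vanish : ∀ k → k < suc (suc n) → k ≢ 1 → idP k * powP h k (suc n) ≡ 0ℚ
  vanish zero          _ _   = ℚP.*-zeroˡ (powP h 0 (suc n))
  vanish (suc zero)    _ 1≢1 = ⊥-elim (1≢1 refl)
  vanish (suc (suc k)) _ _   = ℚP.*-zeroˡ (powP h (suc (suc k)) (suc n))

iterP : PS → ℕ → PS
iterP g zero    = idP
iterP g (suc m) = compP g (iterP g m)

iterP-constant : ∀ g → g 0 ≡ 0ℚ → ∀ m → iterP g m 0 ≡ 0ℚ
iterP-constant g g0≡0 zero    = refl
iterP-constant g g0≡0 (suc m) = compP-constant g (iterP g m) g0≡0

iterP-comm : ∀ g → g 0 ≡ 0ℚ → ∀ m → compP (iterP g m) g ≗ compP g (iterP g m)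
iterP-comm g g0≡0 zero    n = trans (compP-idˡ g g0≡0 n) (sym (compP-idʳ g n))
iterP-comm g g0≡0 (suc m) n = begin
  compP (compP g (iterP g m)) g n    ≡⟨ compP-assoc g (iterP g m) g (iterP-constant g g0≡0 m) g0≡0 n ⟩
  compP g (compP (iterP g m) g) n    ≡⟨ compP-cong {g} (λ _ → refl) (iterP-comm g g0≡0 m) n ⟩
  compP g (compP g (iterP g m)) n    ∎

E-iterP : ∀ m → E m ≗ compP expP (iterP expP₀ m)
E-iterP zero    n = sym (compP-idʳ expP n)
E-iterP (suc m) n = begin
  compP (E m) expP₀ n
    ≡⟨ compP-cong (E-iterP m) (λ _ → refl) n ⟩
  compP (compP expP (iterP expP₀ m)) expP₀ n
    ≡⟨ compP-assoc expP (iterP expP₀ m) expP₀ (iterP-constant expP₀ refl m) refl n ⟩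
  compP expP (compP (iterP expP₀ m) expP₀) n
    ≡⟨ compP-cong {expP} (λ _ → refl) (iterP-comm expP₀ refl m) n ⟩
  compP expP (iterP expP₀ (suc m)) n ∎

-- The exponential specialisation

allOnes : Partition → Bool
allOnes = all (ℕ._≡ᵇ 1)

keepIf : Bool → ℚ → ℚ
keepIf b a = if b then a else 0ℚ

ex : Sym → ℚ
ex []             = 0ℚ
ex ((a , λs) ∷ F) = keepIf (allOnes λs) a + ex F

exSeries : Series → PS
exSeries A n = ex (A n)

keepIf-* : ∀ b c a → keepIf b (c * a) ≡ c * keepIf b a
keepIf-* true  c a = refl
keepIf-* false c a = sym (ℚP.*-zeroʳ c)

keepIf-∧ : ∀ b c x y → keepIf (b ∧ c) (x * y) ≡ keepIf b x * keepIf c y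
keepIf-∧ true  true  x y = refl
keepIf-∧ true  false x y = sym (ℚP.*-zeroʳ x)
keepIf-∧ false c     x y = sym (ℚP.*-zeroˡ (keepIf c y))

mulP-keepIfʳ : ∀ b f g n → mulP f (keepIf b ∘ g) n ≡ keepIf b (mulP f g n)
mulP-keepIfʳ true  f g n = refl
mulP-keepIfʳ false f g n = sumTo-zero (suc n) (λ i _ → ℚP.*-zeroʳ (f i))

ex-++ : ∀ F G → ex (F ++ G) ≡ ex F + ex G
ex-++ []              G = sym (ℚP.+-identityˡ (ex G))
ex-++ ((a , λs) ∷ F) G =
  trans (cong (keepIf (allOnes λs) a +_) (ex-++ F G)) (sym (ℚP.+-assoc (keepIf (allOnes λs) a) (ex F) (ex G)))

ex-sumS-map : ∀ {A : Set} (f : A → Sym) xs → ex (sumS (map f xs)) ≡ sumℚ (map (ex ∘ f) xs)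
ex-sumS-map f []       = refl
ex-sumS-map f (x ∷ xs) = trans (ex-++ (f x) (sumS (map f xs))) (cong (ex (f x) +_) (ex-sumS-map f xs))

ex-Σ≤ : ∀ n f → ex (Σ≤ n f) ≡ Σ[ i < suc n ] ex (f i)
ex-Σ≤ n f = ex-sumS-map f (upTo (suc n))

ex-scaleS : ∀ c F → ex (scaleS c F) ≡ c * ex F
ex-scaleS c []              = sym (ℚP.*-zeroʳ c)
ex-scaleS c ((a , λs) ∷ F) = begin
  keepIf (allOnes λs) (c * a) + ex (scaleS c F) ≡⟨ cong₂ _+_ (keepIf-* (allOnes λs) c a) (ex-scaleS c F) ⟩
  c * keepIf (allOnes λs) a + c * ex F          ≡⟨ ℚP.*-distribˡ-+ c _ _ ⟨
  c * (keepIf (allOnes λs) a + ex F)            ∎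

allOnes-insertPart : ∀ k λs → allOnes (insertPart k λs) ≡ (k ℕ.≡ᵇ 1) ∧ allOnes λs
allOnes-insertPart k []       = refl
allOnes-insertPart k (j ∷ λs) with does (j ℕ.≤? k)
... | true  = refl
... | false = begin
  (j ℕ.≡ᵇ 1) ∧ allOnes (insertPart k λs)       ≡⟨ cong ((j ℕ.≡ᵇ 1) ∧_) (allOnes-insertPart k λs) ⟩
  (j ℕ.≡ᵇ 1) ∧ ((k ℕ.≡ᵇ 1) ∧ allOnes λs)       ≡⟨ BoolP.∧-assoc (j ℕ.≡ᵇ 1) _ _ ⟨
  ((j ℕ.≡ᵇ 1) ∧ (k ℕ.≡ᵇ 1)) ∧ allOnes λs       ≡⟨ cong (_∧ allOnes λs) (BoolP.∧-comm (j ℕ.≡ᵇ 1) _) ⟩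
  ((k ℕ.≡ᵇ 1) ∧ (j ℕ.≡ᵇ 1)) ∧ allOnes λs       ≡⟨ BoolP.∧-assoc (k ℕ.≡ᵇ 1) _ _ ⟩
  (k ℕ.≡ᵇ 1) ∧ ((j ℕ.≡ᵇ 1) ∧ allOnes λs)       ∎

allOnes-unionPart : ∀ λs μs → allOnes (unionPart λs μs) ≡ allOnes λs ∧ allOnes μs
allOnes-unionPart []       μs = refl
allOnes-unionPart (k ∷ λs) μs = begin
  allOnes (insertPart k (unionPart λs μs))     ≡⟨ allOnes-insertPart k (unionPart λs μs) ⟩
  (k ℕ.≡ᵇ 1) ∧ allOnes (unionPart λs μs)       ≡⟨ cong ((k ℕ.≡ᵇ 1) ∧_) (allOnes-unionPart λs μs) ⟩
  (k ℕ.≡ᵇ 1) ∧ (allOnes λs ∧ allOnes μs)       ≡⟨ BoolP.∧-assoc (k ℕ.≡ᵇ 1) _ _ ⟨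
  ((k ℕ.≡ᵇ 1) ∧ allOnes λs) ∧ allOnes μs       ∎

allOnes-replicate-1 : ∀ n → allOnes (replicate n 1) ≡ true
allOnes-replicate-1 zero    = refl
allOnes-replicate-1 (suc n) = allOnes-replicate-1 n

size-replicate-1 : ∀ n → size (replicate n 1) ≡ n
size-replicate-1 zero    = refl
size-replicate-1 (suc n) = cong suc (size-replicate-1 n)

allOnes⇒≡replicate : ∀ λs → allOnes λs ≡ true → λs ≡ replicate (length λs) 1
allOnes⇒≡replicate []                 _    = refl
allOnes⇒≡replicate (1 ∷ λs)           ones = cong (1 ∷_) (allOnes⇒≡replicate λs ones)
allOnes⇒≡replicate (0 ∷ λs)           ()
allOnes⇒≡replicate (suc (suc k) ∷ λs) ()

allOnes⇒length≡size : ∀ λs → allOnes λs ≡ true → length λs ≡ size λs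
allOnes⇒length≡size λs ones = begin
  length λs                           ≡⟨ size-replicate-1 (length λs) ⟨
  size (replicate (length λs) 1)      ≡⟨ cong size (allOnes⇒≡replicate λs ones) ⟨
  size λs                             ∎

mulS-∷ : ∀ t F G → mulS (t ∷ F) G ≡ mulS (t ∷ []) G ++ mulS F G
mulS-∷ t F G = cong (_++ mulS F G) (sym (LP.++-identityʳ _))

ex-mulS-single : ∀ a λs G → ex (mulS ((a , λs) ∷ []) G) ≡ keepIf (allOnes λs) a * ex G
ex-mulS-single a λs []              = sym (ℚP.*-zeroʳ (keepIf (allOnes λs) a))
ex-mulS-single a λs ((b , μs) ∷ G) = begin
  keepIf (allOnes (unionPart λs μs)) (a * b) + ex (mulS ((a , λs) ∷ []) G)
    ≡⟨ cong₂ _+_ (trans (cong (λ t → keepIf t (a * b)) (allOnes-unionPart λs μs)) (keepIf-∧ (allOnes λs) (allOnes μs) a b))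
                 (ex-mulS-single a λs G) ⟩
  keepIf (allOnes λs) a * keepIf (allOnes μs) b + keepIf (allOnes λs) a * ex G
    ≡⟨ ℚP.*-distribˡ-+ (keepIf (allOnes λs) a) _ _ ⟨
  keepIf (allOnes λs) a * (keepIf (allOnes μs) b + ex G) ∎

ex-mulS : ∀ F G → ex (mulS F G) ≡ ex F * ex G
ex-mulS []              G = sym (ℚP.*-zeroˡ (ex G))
ex-mulS ((a , λs) ∷ F) G = begin
  ex (mulS ((a , λs) ∷ F) G)                              ≡⟨ cong ex (mulS-∷ (a , λs) F G) ⟩
  ex (mulS ((a , λs) ∷ []) G ++ mulS F G)                 ≡⟨ ex-++ (mulS ((a , λs) ∷ []) G) (mulS F G) ⟩
  ex (mulS ((a , λs) ∷ []) G) + ex (mulS F G)             ≡⟨ cong₂ _+_ (ex-mulS-single a λs G) (ex-mulS F G) ⟩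
  keepIf (allOnes λs) a * ex G + ex F * ex G              ≡⟨ ℚP.*-distribʳ-+ (ex G) (keepIf (allOnes λs) a) (ex F) ⟨
  (keepIf (allOnes λs) a + ex F) * ex G                   ∎

-- Homogeneity

size-insertPart : ∀ k λs → size (insertPart k λs) ≡ k ℕ.+ size λs
size-insertPart k []       = refl
size-insertPart k (j ∷ λs) with does (j ℕ.≤? k)
... | true  = refl
... | false = trans (cong (j ℕ.+_) (size-insertPart k λs)) (+-left-comm j k (size λs))

size-unionPart : ∀ λs μs → size (unionPart λs μs) ≡ size λs ℕ.+ size μs
size-unionPart []       μs = refl
size-unionPart (k ∷ λs) μs =
  trans (size-insertPart k (unionPart λs μs)) (trans (cong (k ℕ.+_) (size-unionPart λs μs)) (sym (ℕP.+-assoc k _ _)))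

size-map-* : ∀ k λs → size (map (k ℕ.*_) λs) ≡ k ℕ.* size λs
size-map-* k []       = sym (ℕP.*-zeroʳ k)
size-map-* k (j ∷ λs) = trans (cong (k ℕ.* j ℕ.+_) (size-map-* k λs)) (sym (ℕP.*-distribˡ-+ k j (size λs)))

Homogeneous : ℕ → Sym → Set
Homogeneous d = All (λ t → size (proj₂ t) ≡ d)

Graded : Series → Set
Graded A = ∀ d → Homogeneous d (A d)

Homogeneous-mulS : ∀ {i j} F G → Homogeneous i F → Homogeneous j G → Homogeneous (i ℕ.+ j) (mulS F G)
Homogeneous-mulS []              G _             _   = []
Homogeneous-mulS ((a , λs) ∷ F) G (|λ|≡i ∷ hF) hG =
  subst (Homogeneous _) (sym (mulS-∷ (a , λs) F G)) (AllP.++⁺ (row G hG) (Homogeneous-mulS F G hF hG))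
  where
  row : ∀ {j} G → Homogeneous j G → Homogeneous _ (mulS ((a , λs) ∷ []) G)
  row []              []             = []
  row ((b , μs) ∷ G) (|μ|≡j ∷ hG) = trans (size-unionPart λs μs) (cong₂ ℕ._+_ |λ|≡i |μ|≡j) ∷ row G hG

Homogeneous-scaleS : ∀ {d} c F → Homogeneous d F → Homogeneous d (scaleS c F)
Homogeneous-scaleS c []              []            = []
Homogeneous-scaleS c ((a , λs) ∷ F) (|λ|≡d ∷ hF) = |λ|≡d ∷ Homogeneous-scaleS c F hF

Homogeneous-pleth-p-Sym : ∀ {d} k F → Homogeneous d F → Homogeneous (k ℕ.* d) (pleth-p-Sym k F)
Homogeneous-pleth-p-Sym k []              []            = []
Homogeneous-pleth-p-Sym k ((a , λs) ∷ F) (|λ|≡d ∷ hF) =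
  trans (size-map-* k λs) (cong (k ℕ.*_) |λ|≡d) ∷ Homogeneous-pleth-p-Sym k F hF

Homogeneous-sumS-map : ∀ {A : Set} {d} (f : A → Sym) xs → (∀ x → x ∈ xs → Homogeneous d (f x)) →
  Homogeneous d (sumS (map f xs))
Homogeneous-sumS-map f []       _  = []
Homogeneous-sumS-map f (x ∷ xs) hf = AllP.++⁺ (hf x (here refl)) (Homogeneous-sumS-map f xs (λ y y∈ → hf y (there y∈)))

Homogeneous-Σ≤ : ∀ {d} n f → (∀ i → i ≤ n → Homogeneous d (f i)) → Homogeneous d (Σ≤ n f)
Homogeneous-Σ≤ n f hf = Homogeneous-sumS-map f (upTo (suc n)) (λ i i∈ → hf i (ℕP.≤-pred (∈P.∈-upTo⁻ i∈)))

Graded-oneSer : Graded oneSer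
Graded-oneSer zero    = refl ∷ []
Graded-oneSer (suc n) = []

Graded-mulSer : ∀ A B → Graded A → Graded B → Graded (mulSer A B)
Graded-mulSer A B gA gB n = Homogeneous-Σ≤ n (λ i → mulS (A i) (B (n ℕ.∸ i))) (λ i i≤n →
  subst (λ d → Homogeneous d (mulS (A i) (B (n ℕ.∸ i)))) (ℕP.m+[n∸m]≡n i≤n)
        (Homogeneous-mulS (A i) (B (n ℕ.∸ i)) (gA i) (gB (n ℕ.∸ i))))

Graded-pleth-p : ∀ k A → Graded A → Graded (pleth-p k A)
Graded-pleth-p k A gA n = Homogeneous-Σ≤ n _ (λ d _ → degree-n d)
  where
  degree-n : ∀ d → Homogeneous n (if ⌊ k ℕ.* d ≟ n ⌋ then pleth-p-Sym k (A d) else zeroS)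
  degree-n d with k ℕ.* d ≟ n
  ... | yes k*d≡n = subst (λ m → Homogeneous m (pleth-p-Sym k (A d))) k*d≡n (Homogeneous-pleth-p-Sym k (A d) (gA d))
  ... | no  _     = []

Graded-pleth-pλ : ∀ A → Graded A → ∀ λs → Graded (pleth-pλ λs A)
Graded-pleth-pλ A gA []       = Graded-oneSer
Graded-pleth-pλ A gA (k ∷ λs) =
  Graded-mulSer (pleth-p k A) (pleth-pλ λs A) (Graded-pleth-p k A gA) (Graded-pleth-pλ A gA λs)

Graded-pleth : ∀ F A → Graded A → Graded (pleth F A)
Graded-pleth F A gA n = Homogeneous-Σ≤ n _ (λ d _ →
  Homogeneous-sumS-map _ (F d) (λ { (c , λs) _ → Homogeneous-scaleS c (pleth-pλ λs A n) (Graded-pleth-pλ A gA λs n) }))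

ex-mulSer : ∀ A B → exSeries (mulSer A B) ≗ mulP (exSeries A) (exSeries B)
ex-mulSer A B n =
  trans (ex-Σ≤ n (λ i → mulS (A i) (B (n ℕ.∸ i)))) (sumTo-cong (suc n) (λ i _ → ex-mulS (A i) (B (n ℕ.∸ i))))

ex-pleth-p-Sym-one : ∀ F → ex (pleth-p-Sym 1 F) ≡ ex F
ex-pleth-p-Sym-one []              = refl
ex-pleth-p-Sym-one ((a , λs) ∷ F) =
  cong₂ _+_ (cong (λ μs → keepIf (allOnes μs) a) (trans (LP.map-cong ℕP.*-identityˡ λs) (LP.map-id λs)))
            (ex-pleth-p-Sym-one F)

ex-pleth-p-one : ∀ A → exSeries (pleth-p 1 A) ≗ exSeries A
ex-pleth-p-one A n =
  trans (ex-Σ≤ n summand)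
        (trans (sumTo-cong (suc n) (λ d _ → degree d)) (sumTo-δ (suc n) n (exSeries A) (⊥-elim ∘ ℕP.<-irrefl refl)))
  where
  summand : ℕ → Sym
  summand d = if ⌊ 1 ℕ.* d ≟ n ⌋ then pleth-p-Sym 1 (A d) else zeroS
  degree : ∀ d → ex (summand d) ≡ δ n d * ex (A d)
  degree d with 1 ℕ.* d ≟ n
  ... | yes refl = trans (ex-pleth-p-Sym-one (A d))
                         (sym (trans (cong (λ m → δ m d * ex (A d)) (ℕP.*-identityˡ d)) (δ-refl-* d (ex (A d)))))
  ... | no  1*d≢n = sym (δ-≢-* (λ n≡d → 1*d≢n (trans (ℕP.*-identityˡ d) (sym n≡d))) (ex (A d)))

ex-pleth-p-Sym-≢1 : ∀ {d} k → k ≢ 1 → ∀ F → Homogeneous (suc d) F → ex (pleth-p-Sym k F) ≡ 0ℚ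
ex-pleth-p-Sym-≢1 k k≢1 []                    []       = refl
ex-pleth-p-Sym-≢1 k k≢1 ((a , j ∷ λs) ∷ F) (_ ∷ hF) =
  trans (cong₂ _+_ (cong (λ b → keepIf (b ∧ allOnes (map (k ℕ.*_) λs)) a) k*j≢1) (ex-pleth-p-Sym-≢1 k k≢1 F hF))
        (ℚP.+-identityˡ 0ℚ)
  where
  k*j≢1 : (k ℕ.* j ℕ.≡ᵇ 1) ≡ false
  k*j≢1 = dec-false (k ℕ.* j ≟ 1) (k≢1 ∘ ℕP.m*n≡1⇒m≡1 k j)

-- p_k fixes constants, so the hypothesis A 0 ≡ [] cannot be dropped.
ex-pleth-p-≢1 : ∀ k → k ≢ 1 → ∀ A → Graded A → A 0 ≡ [] → ∀ n → exSeries (pleth-p k A) n ≡ 0ℚ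
ex-pleth-p-≢1 k k≢1 A gA A0≡[] n = trans (ex-Σ≤ n summand) (sumTo-zero (suc n) (λ d _ → degree d))
  where
  summand : ℕ → Sym
  summand d = if ⌊ k ℕ.* d ≟ n ⌋ then pleth-p-Sym k (A d) else zeroS
  degree : ∀ d → ex (summand d) ≡ 0ℚ
  degree d with k ℕ.* d ≟ n
  ... | no _ = refl
  degree zero    | yes _ = cong (ex ∘ pleth-p-Sym k) A0≡[]
  degree (suc d) | yes _ = ex-pleth-p-Sym-≢1 k k≢1 (A (suc d)) (gA (suc d))

ex-pleth-pλ : ∀ A → Graded A → A 0 ≡ [] → ∀ λs n →
  exSeries (pleth-pλ λs A) n ≡ keepIf (allOnes λs) (powP (exSeries A) (length λs) n)
ex-pleth-pλ A gA A0≡[] []       zero    = ℚP.+-identityʳ 1ℚ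
ex-pleth-pλ A gA A0≡[] []       (suc n) = refl
ex-pleth-pλ A gA A0≡[] (k ∷ λs) n with k ℕ.≟ 1
... | yes refl = begin
  exSeries (mulSer (pleth-p 1 A) (pleth-pλ λs A)) n
    ≡⟨ ex-mulSer (pleth-p 1 A) (pleth-pλ λs A) n ⟩
  mulP (exSeries (pleth-p 1 A)) (exSeries (pleth-pλ λs A)) n
    ≡⟨ mulP-cong (ex-pleth-p-one A) (ex-pleth-pλ A gA A0≡[] λs) n ⟩
  mulP (exSeries A) (keepIf (allOnes λs) ∘ powP (exSeries A) (length λs)) n
    ≡⟨ mulP-keepIfʳ (allOnes λs) (exSeries A) (powP (exSeries A) (length λs)) n ⟩
  keepIf (allOnes λs) (powP (exSeries A) (suc (length λs)) n) ∎
... | no k≢1 = begin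
  exSeries (mulSer (pleth-p k A) (pleth-pλ λs A)) n
    ≡⟨ ex-mulSer (pleth-p k A) (pleth-pλ λs A) n ⟩
  mulP (exSeries (pleth-p k A)) (exSeries (pleth-pλ λs A)) n
    ≡⟨ mulP-zeroˡ (exSeries (pleth-p k A)) (exSeries (pleth-pλ λs A)) (ex-pleth-p-≢1 k k≢1 A gA A0≡[]) n ⟩
  0ℚ
    ≡⟨ cong (λ b → keepIf (b ∧ allOnes λs) (powP (exSeries A) (suc (length λs)) n)) (dec-false (k ℕ.≟ 1) k≢1) ⟨
  keepIf (allOnes (k ∷ λs)) (powP (exSeries A) (length (k ∷ λs)) n) ∎

ex-pleth-term : ∀ A → Graded A → A 0 ≡ [] → ∀ n c λs →
  ex (scaleS c (pleth-pλ λs A n)) ≡ keepIf (allOnes λs) c * powP (exSeries A) (size λs) n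
ex-pleth-term A gA A0≡[] n c λs = begin
  ex (scaleS c (pleth-pλ λs A n))                                   ≡⟨ ex-scaleS c (pleth-pλ λs A n) ⟩
  c * exSeries (pleth-pλ λs A) n                                    ≡⟨ cong (c *_) (ex-pleth-pλ A gA A0≡[] λs n) ⟩
  c * keepIf (allOnes λs) (powP (exSeries A) (length λs) n)         ≡⟨ by-allOnes (allOnes λs) refl ⟩
  keepIf (allOnes λs) c * powP (exSeries A) (size λs) n             ∎
  where
  by-allOnes : ∀ b → allOnes λs ≡ b →
    c * keepIf b (powP (exSeries A) (length λs) n) ≡ keepIf b c * powP (exSeries A) (size λs) n
  by-allOnes true  ones = cong (λ l → c * powP (exSeries A) l n) (allOnes⇒length≡size λs ones)
  by-allOnes false _    = trans (ℚP.*-zeroʳ c) (sym (ℚP.*-zeroˡ (powP (exSeries A) (size λs) n)))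

ex-pleth : ∀ F A → Graded F → Graded A → A 0 ≡ [] → exSeries (pleth F A) ≗ compP (exSeries F) (exSeries A)
ex-pleth F A gF gA A0≡[] n =
  trans (ex-Σ≤ n (λ d → sumS (map term (F d)))) (sumTo-cong (suc n) (λ d _ → degree (F d) (gF d)))
  where
  term : ℚ × Partition → Sym
  term (c , λs) = scaleS c (pleth-pλ λs A n)
  degree : ∀ {d} G → Homogeneous d G → ex (sumS (map term G)) ≡ ex G * powP (exSeries A) d n
  degree {d} []         []            = sym (ℚP.*-zeroˡ (powP (exSeries A) d n))
  degree ((c , λs) ∷ G) (refl ∷ hG) = begin
    ex (term (c , λs) ++ sumS (map term G))
      ≡⟨ ex-++ (term (c , λs)) (sumS (map term G)) ⟩
    ex (term (c , λs)) + ex (sumS (map term G))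
      ≡⟨ cong₂ _+_ (ex-pleth-term A gA A0≡[] n c λs) (degree G hG) ⟩
    keepIf (allOnes λs) c * powP (exSeries A) (size λs) n + ex G * powP (exSeries A) (size λs) n
      ≡⟨ ℚP.*-distribʳ-+ _ (keepIf (allOnes λs) c) (ex G) ⟨
    (keepIf (allOnes λs) c + ex G) * powP (exSeries A) (size λs) n ∎

-- Partitions, h_n and the pairing with p_{1ⁿ}

block : ℕ → ℕ → ℕ → List Partition
block n k j = map (replicate j (suc k) ++_) (partitionsLe (n ℕ.∸ j ℕ.* suc k) k)

partitionsLe-suc : ∀ n k →
  partitionsLe n (suc k) ≡ concatMap (block n k) (filter (λ j → j ℕ.* suc k ℕ.≤? n) (upTo (suc n)))
partitionsLe-suc zero    k = refl
partitionsLe-suc (suc n) k = refl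

size-replicate-++ : ∀ j x μs → size (replicate j x ++ μs) ≡ j ℕ.* x ℕ.+ size μs
size-replicate-++ zero    x μs = refl
size-replicate-++ (suc j) x μs = trans (cong (x ℕ.+_) (size-replicate-++ j x μs)) (sym (ℕP.+-assoc x (j ℕ.* x) (size μs)))

partitionsLe-size : ∀ n k → All (λ μs → size μs ≡ n) (partitionsLe n k)
partitionsLe-size zero    zero    = refl ∷ []
partitionsLe-size (suc n) zero    = []
partitionsLe-size n       (suc k) = subst (All (λ μs → size μs ≡ n)) (sym (partitionsLe-suc n k))
  (AllP.concat⁺ (AllP.map⁺ (All.map block-size (AllP.all-filter (λ j → j ℕ.* suc k ℕ.≤? n) (upTo (suc n))))))
  where
  block-size : ∀ {j} → j ℕ.* suc k ≤ n → All (λ μs → size μs ≡ n) (block n k j)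
  block-size {j} j*k≤n = AllP.map⁺ (All.map
    (λ {μs} |μ|≡ → trans (size-replicate-++ j (suc k) μs) (trans (cong (j ℕ.* suc k ℕ.+_) |μ|≡) (ℕP.m+[n∸m]≡n j*k≤n)))
    (partitionsLe-size (n ℕ.∸ j ℕ.* suc k) k))

sumAllOnes : (Partition → ℚ) → List Partition → ℚ
sumAllOnes φ μss = sumℚ (map (λ μs → keepIf (allOnes μs) (φ μs)) μss)

sumAllOnes-concatMap : ∀ {A : Set} φ (g : A → List Partition) xs →
  sumAllOnes φ (concatMap g xs) ≡ sumℚ (map (sumAllOnes φ ∘ g) xs)
sumAllOnes-concatMap φ g []       = refl
sumAllOnes-concatMap φ g (x ∷ xs) = begin
  sumℚ (map _ (g x ++ concatMap g xs))                         ≡⟨ cong sumℚ (LP.map-++ _ (g x) (concatMap g xs)) ⟩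
  sumℚ (map _ (g x) ++ map _ (concatMap g xs))                 ≡⟨ sumℚ-++ (map _ (g x)) _ ⟩
  sumAllOnes φ (g x) + sumAllOnes φ (concatMap g xs)           ≡⟨ cong (sumAllOnes φ (g x) +_) (sumAllOnes-concatMap φ g xs) ⟩
  sumAllOnes φ (g x) + sumℚ (map (sumAllOnes φ ∘ g) xs)        ∎

sumAllOnes-block-1 : ∀ φ n j → j ≤ n → sumAllOnes φ (block n 0 j) ≡ δ n j * φ (replicate n 1)
sumAllOnes-block-1 φ n j j≤n with n ℕ.∸ j ℕ.* 1 in n∸j≡
... | zero = begin
  keepIf (allOnes (replicate j 1 ++ [])) (φ (replicate j 1 ++ [])) + 0ℚ
    ≡⟨ ℚP.+-identityʳ _ ⟩
  keepIf (allOnes (replicate j 1 ++ [])) (φ (replicate j 1 ++ []))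
    ≡⟨ cong (λ μs → keepIf (allOnes μs) (φ μs)) (LP.++-identityʳ _) ⟩
  keepIf (allOnes (replicate j 1)) (φ (replicate j 1))
    ≡⟨ cong (λ b → keepIf b (φ (replicate j 1))) (allOnes-replicate-1 j) ⟩
  φ (replicate j 1)
    ≡⟨ subst (λ m → δ m j * φ (replicate m 1) ≡ φ (replicate j 1)) (sym n≡j) (δ-refl-* j _) ⟨
  δ n j * φ (replicate n 1) ∎
  where
  n≡j : n ≡ j
  n≡j = ℕP.≤-antisym (ℕP.m∸n≡0⇒m≤n (trans (cong (n ℕ.∸_) (sym (ℕP.*-identityʳ j))) n∸j≡)) j≤n
... | suc _ = sym (δ-≢-* {n} {j} (λ { refl → ℕP.0≢1+n (trans (sym n∸n*1≡0) n∸j≡) }) _)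
  where
  n∸n*1≡0 : n ℕ.∸ n ℕ.* 1 ≡ 0
  n∸n*1≡0 = trans (cong (n ℕ.∸_) (ℕP.*-identityʳ n)) (ℕP.n∸n≡0 n)

sumAllOnes-partitionsLe : ∀ φ n k → sumAllOnes φ (partitionsLe n (suc k)) ≡ φ (replicate n 1)
sumAllOnes-partitionsLe φ n zero = begin
  sumAllOnes φ (partitionsLe n 1)
    ≡⟨ cong (sumAllOnes φ) (partitionsLe-suc n 0) ⟩
  sumAllOnes φ (concatMap (block n 0) (filter (λ j → j ℕ.* 1 ℕ.≤? n) (upTo (suc n))))
    ≡⟨ cong (sumAllOnes φ ∘ concatMap (block n 0)) (LP.filter-all (λ j → j ℕ.* 1 ℕ.≤? n) (All.tabulate below)) ⟩
  sumAllOnes φ (concatMap (block n 0) (upTo (suc n)))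
    ≡⟨ sumAllOnes-concatMap φ (block n 0) (upTo (suc n)) ⟩
  Σ[ j < suc n ] sumAllOnes φ (block n 0 j)
    ≡⟨ sumTo-cong (suc n) (λ j j≤n → sumAllOnes-block-1 φ n j (ℕP.≤-pred j≤n)) ⟩
  Σ[ j < suc n ] δ n j * φ (replicate n 1)
    ≡⟨ sumTo-δ (suc n) n (λ _ → φ (replicate n 1)) (⊥-elim ∘ ℕP.<-irrefl refl) ⟩
  φ (replicate n 1) ∎
  where
  below : ∀ {j} → j ∈ upTo (suc n) → j ℕ.* 1 ≤ n
  below {j} j∈ = subst (_≤ n) (sym (ℕP.*-identityʳ j)) (ℕP.≤-pred (∈P.∈-upTo⁻ j∈))
sumAllOnes-partitionsLe φ n (suc k) = begin
  sumAllOnes φ (partitionsLe n (suc (suc k)))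
    ≡⟨ cong (sumAllOnes φ) (partitionsLe-suc n (suc k)) ⟩
  sumAllOnes φ (concatMap (block n (suc k)) (0 ∷ filter fits (applyUpTo suc n)))
    ≡⟨ sumAllOnes-concatMap φ (block n (suc k)) (0 ∷ filter fits (applyUpTo suc n)) ⟩
  sumAllOnes φ (block n (suc k) 0) + sumℚ (map (sumAllOnes φ ∘ block n (suc k)) (filter fits (applyUpTo suc n)))
    ≡⟨ cong₂ _+_ (trans (cong (sumAllOnes φ) (LP.map-id (partitionsLe n (suc k)))) (sumAllOnes-partitionsLe φ n k))
                 (sumℚ-zero (map (sumAllOnes φ ∘ block n (suc k)) (filter fits (applyUpTo suc n)))
                            (AllP.map⁺ (AllP.filter⁺ fits (AllP.applyUpTo⁺₂ suc n (λ j → big-block-vanishes j))))) ⟩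
  φ (replicate n 1) + 0ℚ
    ≡⟨ ℚP.+-identityʳ _ ⟩
  φ (replicate n 1) ∎
  where
  fits = λ j → j ℕ.* suc (suc k) ℕ.≤? n
  big-block-vanishes : ∀ j → sumAllOnes φ (block n (suc k) (suc j)) ≡ 0ℚ
  big-block-vanishes j = sumℚ-zero (map (λ μs → keepIf (allOnes μs) (φ μs)) (block n (suc k) (suc j)))
    (AllP.map⁺ (AllP.map⁺ (All.universal (λ _ → refl) (partitionsLe (n ℕ.∸ suc j ℕ.* suc (suc k)) (suc k)))))

mult-1-replicate-1 : ∀ n → mult 1 (replicate n 1) ≡ n
mult-1-replicate-1 zero    = refl
mult-1-replicate-1 (suc n) = cong suc (mult-1-replicate-1 n)

mult-2+-replicate-1 : ∀ n j → mult (suc (suc j)) (replicate n 1) ≡ 0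
mult-2+-replicate-1 zero    j = refl
mult-2+-replicate-1 (suc n) j = mult-2+-replicate-1 n j

prodℕ-ones : ∀ xs → All (_≡ 1) xs → prodℕ xs ≡ 1
prodℕ-ones []       []            = refl
prodℕ-ones (x ∷ xs) (x≡1 ∷ xs≡1) = cong₂ ℕ._*_ x≡1 (prodℕ-ones xs xs≡1)

z-replicate-1 : ∀ n → z (replicate n 1) ≡ n !
z-replicate-1 zero    = refl
z-replicate-1 (suc n) = begin
  prodℕ (map factor (upTo (size ones)))
    ≡⟨ cong (λ l → prodℕ (map factor (upTo l))) (size-replicate-1 (suc n)) ⟩
  factor 0 ℕ.* prodℕ (map factor (applyUpTo suc n))
    ≡⟨ cong₂ ℕ._*_ factor-one (prodℕ-ones _ (AllP.map⁺ (AllP.applyUpTo⁺₂ suc n factor-big))) ⟩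
  suc n ! ℕ.* 1
    ≡⟨ ℕP.*-identityʳ _ ⟩
  suc n ! ∎
  where
  ones = replicate (suc n) 1
  factor : ℕ → ℕ
  factor j = mult (suc j) ones ! ℕ.* suc j ℕ.^ mult (suc j) ones
  factor-one : factor 0 ≡ suc n !
  factor-one = begin
    mult 1 ones ! ℕ.* 1 ℕ.^ mult 1 ones   ≡⟨ cong (λ m → m ! ℕ.* 1 ℕ.^ m) (mult-1-replicate-1 (suc n)) ⟩
    suc n ! ℕ.* 1 ℕ.^ suc n               ≡⟨ cong (suc n ! ℕ.*_) (ℕP.^-zeroˡ (suc n)) ⟩
    suc n ! ℕ.* 1                         ≡⟨ ℕP.*-identityʳ _ ⟩
    suc n !                               ∎
  factor-big : ∀ j → factor (suc j) ≡ 1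
  factor-big j = cong (λ m → m ! ℕ.* suc (suc j) ℕ.^ m) (mult-2+-replicate-1 (suc n) j)

factorialℚ : ℕ → ℚ
factorialℚ n = ℤ.+ (n !) ℚ./ 1

hall-p1^ : ∀ n F → Homogeneous n F → hall F (p1^ n) ≡ ex F * factorialℚ n
hall-p1^ n []              []            = sym (ℚP.*-zeroˡ (factorialℚ n))
hall-p1^ n ((a , λs) ∷ F) (|λ|≡n ∷ hF) =
  trans (cong₂ _+_ term (hall-p1^ n F hF)) (sym (ℚP.*-distribʳ-+ (factorialℚ n) (keepIf (allOnes λs) a) (ex F)))
  where
  term : (if ⌊ LP.≡-dec _≟_ λs (replicate n 1) ⌋ then a * 1ℚ * (ℤ.+ z λs ℚ./ 1) else 0ℚ) ≡
         keepIf (allOnes λs) a * factorialℚ n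
  term with LP.≡-dec _≟_ λs (replicate n 1)
  ... | yes refl = begin
    a * 1ℚ * (ℤ.+ z (replicate n 1) ℚ./ 1)
      ≡⟨ cong₂ _*_ (ℚP.*-identityʳ a) (cong (λ m → ℤ.+ m ℚ./ 1) (z-replicate-1 n)) ⟩
    a * factorialℚ n
      ≡⟨ cong (λ b → keepIf b a * factorialℚ n) (allOnes-replicate-1 n) ⟨
    keepIf (allOnes (replicate n 1)) a * factorialℚ n ∎
  ... | no λ≢1ⁿ with allOnes λs in ones
  ...   | true  = ⊥-elim (λ≢1ⁿ (trans (allOnes⇒≡replicate λs ones)
                    (cong (λ m → replicate m 1) (trans (allOnes⇒length≡size λs ones) |λ|≡n))))
  ...   | false = sym (ℚP.*-zeroˡ (factorialℚ n))

ex-map-weight : ∀ (c : Partition → ℚ) μss → ex (map (λ μs → (c μs , μs)) μss) ≡ sumAllOnes c μss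
ex-map-weight c []         = refl
ex-map-weight c (μs ∷ μss) = cong (keepIf (allOnes μs) (c μs) +_) (ex-map-weight c μss)

-- The NonZero instance required by ℚ._/_ depends on the denominator, so cong cannot abstract over it.
1/-cong : ∀ {a b} → a ≡ b → .{{_ : ℕ.NonZero a}} .{{_ : ℕ.NonZero b}} → ℤ.+ 1 ℚ./ a ≡ ℤ.+ 1 ℚ./ b
1/-cong refl = refl

ex-h : exSeries h ≗ expP
ex-h zero    = refl
ex-h (suc n) = begin
  ex (h (suc n))
    ≡⟨ ex-map-weight 1/z (partitions (suc n)) ⟩
  sumAllOnes 1/z (partitions (suc n))
    ≡⟨ sumAllOnes-partitionsLe 1/z (suc n) n ⟩
  1/z (replicate (suc n) 1)
    ≡⟨ 1/-cong (z-replicate-1 (suc n)) {{z-nonZero (replicate (suc n) 1)}} {{suc n !≢0}} ⟩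
  expP (suc n) ∎
  where
  1/z : Partition → ℚ
  1/z μs = ℚ._/_ (ℤ.+ 1) (z μs) {{z-nonZero μs}}

Graded-h : Graded h
Graded-h d = AllP.map⁺ (partitionsLe-size d d)

Graded-Ω₀ : Graded Ω₀
Graded-Ω₀ zero    = []
Graded-Ω₀ (suc d) = Graded-h (suc d)

Graded-h₁Ser : Graded h₁Ser
Graded-h₁Ser 1             = Graded-h 1
Graded-h₁Ser zero          = []
Graded-h₁Ser (suc (suc d)) = []

Graded-Ω₀^ : ∀ m → Graded (Ω₀^ m)
Graded-Ω₀^ zero    = Graded-h₁Ser
Graded-Ω₀^ (suc m) = Graded-pleth Ω₀ (Ω₀^ m) (Graded-Ω₀^ m)

Ω₀^-constant : ∀ m → Ω₀^ m 0 ≡ []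
Ω₀^-constant zero    = refl
Ω₀^-constant (suc m) = refl

ex-h₁Ser : exSeries h₁Ser ≗ idP
ex-h₁Ser 1             = refl
ex-h₁Ser zero          = refl
ex-h₁Ser (suc (suc n)) = refl

ex-Ω₀ : exSeries Ω₀ ≗ expP₀
ex-Ω₀ zero    = refl
ex-Ω₀ (suc n) = ex-h (suc n)

ex-Ω₀^ : ∀ m → exSeries (Ω₀^ m) ≗ iterP expP₀ m
ex-Ω₀^ zero    = ex-h₁Ser
ex-Ω₀^ (suc m) n =
  trans (ex-pleth Ω₀ (Ω₀^ m) Graded-Ω₀ (Graded-Ω₀^ m) (Ω₀^-constant m) n) (compP-cong ex-Ω₀ (ex-Ω₀^ m) n)

mainTheorem1 : ∀ (n m : ℕ) → b n m ≡ hall (B n m) (p1^ n)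
mainTheorem1 n m = begin
  factorialℚ n * E m n
    ≡⟨ cong (factorialℚ n *_) (E-iterP m n) ⟩
  factorialℚ n * compP expP (iterP expP₀ m) n
    ≡⟨ cong (factorialℚ n *_) (compP-cong ex-h (ex-Ω₀^ m) n) ⟨
  factorialℚ n * compP (exSeries Ω) (exSeries (Ω₀^ m)) n
    ≡⟨ cong (factorialℚ n *_) (ex-pleth Ω (Ω₀^ m) Graded-h (Graded-Ω₀^ m) (Ω₀^-constant m) n) ⟨
  factorialℚ n * ex (B n m)
    ≡⟨ ℚP.*-comm (factorialℚ n) (ex (B n m)) ⟩
  ex (B n m) * factorialℚ n
    ≡⟨ hall-p1^ n (B n m) (Graded-pleth Ω (Ω₀^ m) (Graded-Ω₀^ m) n) ⟨
  hall (B n m) (p1^ n) ∎
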